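{- For all processes $Q,T$: if $Q\Rightarrow_T T$, then $Q\sim T$.
   Context: Fix a countable set of actions. Finite processes: $F ::= 0 \mid \alpha.F \mid F|F$. Processes: $P ::= F \mid\ !\alpha.F \mid P|P$. Finite single-hole contexts: $D ::= [\,] \mid \alpha.D \mid D|F$; contexts: $C ::= D \mid\ !\alpha.D \mid C|P$; $C[F]$ fills the hole with finite $F$. Transitions: $\alpha.F\xrightarrow{\alpha}F$; $!\alpha.F\xrightarrow{\alpha}\ !\alpha.F|F$; if $P_1\xrightarrow{\alpha}P_1'$ then $P_1|P_2\xrightarrow{\alpha}P_1'|P_2$ and $P_2|P_1\xrightarrow{\alpha}P_2|P_1'$. $\sim$ is strong bisimilarity. $\equiv_D$ is the smallest congruence containing the abelian monoid laws for $|$ with neutral $0$ and the distribution law $\alpha.(F|\alpha.F|\cdots|\alpha.F)=\alpha.F|\cdots|\alpha.F$ ($k\ge0$ copies of $\alpha.F$ on the left, $k+1$ on the right). Each process $T$ induces a relation $\to_T$, defined modulo $\equiv_D$ by (B1) $C[\alpha.F]\to_T C[0]$ whenever $T\equiv_D\ !\alpha.F|F'$ for some process $F'$, and (B2) $!\alpha.F|\,!\alpha.F|P\to_T\ !\alpha.F|P$; $\Rightarrow_T$ is its reflexive transitive closure. -}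

module Defs where

open import Data.Product using (Σ; ∃; _×_; _,_)
open import Data.Nat using (ℕ; zero; suc)
open import Relation.Binary.Construct.Closure.ReflexiveTransitive using (Star)

data FProc (Act : Set) : Set where
  𝟘   : FProc Act
  _·_ : Act → FProc Act → FProc Act
  _∥_ : FProc Act → FProc Act → FProc Act

data Proc (Act : Set) : Set where
  fin  : FProc Act → Proc Act
  !_∙_ : Act → FProc Act → Proc Act
  _∣_  : Proc Act → Proc Act → Proc Act

data DCtx (Act : Set) : Set where
  hole : DCtx Act
  _·ᴰ_ : Act → DCtx Act → DCtx Act
  _∥ᴰ_ : DCtx Act → FProc Act → DCtx Act

data Ctx (Act : Set) : Set where
  ctxD  : DCtx Act → Ctx Act
  !ᶜ_∙_ : Act → DCtx Act → Ctx Act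
  _∣ᶜ_  : Ctx Act → Proc Act → Ctx Act

infixr 7 _·_ !_∙_ _·ᴰ_ !ᶜ_∙_
infixl 6 _∥_ _∣_ _∥ᴰ_ _∣ᶜ_

module _ {Act : Set} where

  infix 4 _≡F_ _≡D_ _∼_

  fillD : DCtx Act → FProc Act → FProc Act
  fillD hole      F = F
  fillD (α ·ᴰ D)  F = α · fillD D F
  fillD (D ∥ᴰ G)  F = fillD D F ∥ G

  fill : Ctx Act → FProc Act → Proc Act
  fill (ctxD D)   F = fin (fillD D F)
  fill (!ᶜ α ∙ D) F = ! α ∙ fillD D F
  fill (C ∣ᶜ P)   F = fill C F ∣ P

  data _—F[_]→_ : FProc Act → Act → FProc Act → Set where
    pre  : ∀ {α F} → (α · F) —F[ α ]→ F
    parL : ∀ {α F F' G} → F —F[ α ]→ F' → (F ∥ G) —F[ α ]→ (F' ∥ G)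
    parR : ∀ {α F F' G} → F —F[ α ]→ F' → (G ∥ F) —F[ α ]→ (G ∥ F')

  data _—[_]→_ : Proc Act → Act → Proc Act → Set where
    fin→ : ∀ {α F F'} → F —F[ α ]→ F' → fin F —[ α ]→ fin F'
    rep  : ∀ {α F} → (! α ∙ F) —[ α ]→ (! α ∙ F ∣ fin F)
    parL : ∀ {α P P' Q} → P —[ α ]→ P' → (P ∣ Q) —[ α ]→ (P' ∣ Q)
    parR : ∀ {α P P' Q} → P —[ α ]→ P' → (Q ∣ P) —[ α ]→ (Q ∣ P')

  IsBisimulation : (Proc Act → Proc Act → Set) → Set
  IsBisimulation R =
    ∀ {P Q} → R P Q →
      (∀ {α P'} → P —[ α ]→ P' → ∃ λ Q' → Q —[ α ]→ Q' × R P' Q') ×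
      (∀ {α Q'} → Q —[ α ]→ Q' → ∃ λ P' → P —[ α ]→ P' × R P' Q')

  _∼_ : Proc Act → Proc Act → Set₁
  P ∼ Q = Σ (Proc Act → Proc Act → Set) λ R → IsBisimulation R × R P Q

  copies : ℕ → Act → FProc Act → FProc Act
  copies zero    α F = 𝟘
  copies (suc k) α F = copies k α F ∥ α · F

  data _≡F_ : FProc Act → FProc Act → Set where
    reflF  : ∀ {F} → F ≡F F
    symF   : ∀ {F G} → F ≡F G → G ≡F F
    transF : ∀ {F G H} → F ≡F G → G ≡F H → F ≡F H
    preF   : ∀ {α F G} → F ≡F G → α · F ≡F α · G
    parF   : ∀ {F F' G G'} → F ≡F F' → G ≡F G' → F ∥ G ≡F F' ∥ G'
    assocF : ∀ {F G H} → (F ∥ G) ∥ H ≡F F ∥ (G ∥ H)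
    commF  : ∀ {F G} → F ∥ G ≡F G ∥ F
    unitF  : ∀ {F} → F ∥ 𝟘 ≡F F
    distF  : ∀ {α F} (k : ℕ) →
             α · (F ∥ copies k α F) ≡F copies k α F ∥ α · F

  data _≡D_ : Proc Act → Proc Act → Set where
    reflD  : ∀ {P} → P ≡D P
    symD   : ∀ {P Q} → P ≡D Q → Q ≡D P
    transD : ∀ {P Q R} → P ≡D Q → Q ≡D R → P ≡D R
    finD   : ∀ {F G} → F ≡F G → fin F ≡D fin G
    bangD  : ∀ {α F G} → F ≡F G → ! α ∙ F ≡D ! α ∙ G
    parD   : ∀ {P P' Q Q'} → P ≡D P' → Q ≡D Q' → P ∣ Q ≡D P' ∣ Q'
    assocD : ∀ {P Q R} → (P ∣ Q) ∣ R ≡D P ∣ (Q ∣ R)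
    commD  : ∀ {P Q} → P ∣ Q ≡D Q ∣ P
    unitD  : ∀ {P} → P ∣ fin 𝟘 ≡D P
    -- a parallel composition of finite processes is the same process
    -- whether read as a finite process or as a process (grammar overlap)
    finPar : ∀ {F G} → fin (F ∥ G) ≡D fin F ∣ fin G

  data BaseStep (T : Proc Act) : Proc Act → Proc Act → Set where
    B1 : ∀ {C α F} → (∃ λ F' → T ≡D (! α ∙ F) ∣ F') →
         BaseStep T (fill C (α · F)) (fill C 𝟘)
    B2 : ∀ {α F P} → BaseStep T (! α ∙ F ∣ (! α ∙ F ∣ P)) (! α ∙ F ∣ P)

  _—→[_]_ : Proc Act → Proc Act → Proc Act → Set
  P —→[ T ] Q = ∃ λ P₀ → ∃ λ Q₀ → P ≡D P₀ × BaseStep T P₀ Q₀ × Q₀ ≡D Q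

  _⇒[_]_ : Proc Act → Proc Act → Proc Act → Set
  P ⇒[ T ] Q = Star (λ X Y → X —→[ T ] Y) P Q

-- Induction on the length of Q ⇒_T T: it suffices that a single step P →_T P'
-- with P' ∼ T gives P ∼ T.  A (B2) step merely drops a duplicated replication.
-- A (B1) step erases a prefix α.F from a process that, being bisimilar to
-- T ≡_D !α.F | F', behaves like !α.F | Z; so whenever the erased α.F fires on
-- the left, the right-hand side answers with its replicated copy of α.F.  Both
-- facts are proved by exhibiting bisimulations up to ≡_D, parallel contexts,
-- symmetry and transitivity.
module Submission where

open import Defs
open import Data.Nat using (ℕ; suc)
open import Data.Product using (∃; _×_; _,_; proj₁; proj₂)
open import Data.Sum using (_⊎_; inj₁; inj₂; map₂)
open import Function.Base using (flip; _∘_)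
open import Function.Bundles using (_↣_)
open import Level using (0ℓ)
open import Relation.Binary.Core using (Rel; _⇒_)
open import Relation.Binary.Definitions using (Reflexive; Sym; Trans)
open import Relation.Binary.Construct.Union using (_∪_)
open import Relation.Binary.PropositionalEquality using (_≡_; refl)
open import Relation.Binary.Construct.Closure.ReflexiveTransitive
  using (Star; ε; _◅_; _◅◅_; gmap; map; reverse; return)

module Matching {S A : Set} (_⟶[_]_ : S → A → S → Set) where

  Matches : Rel S 0ℓ → S → S → Set
  Matches R P Q =
    (∀ {α P'} → P ⟶[ α ] P' → ∃ λ Q' → Q ⟶[ α ] Q' × R P' Q') ×
    (∀ {α Q'} → Q ⟶[ α ] Q' → ∃ λ P' → P ⟶[ α ] P' × R P' Q')

  Progresses : Rel S 0ℓ → Rel S 0ℓ → Set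
  Progresses R R' = ∀ {P Q} → R P Q → Matches R' P Q

  private variable R R' R'' : Rel S 0ℓ

  matches-refl : Reflexive R → ∀ {P} → Matches R P P
  matches-refl r = (λ t → _ , t , r) , (λ t → _ , t , r)

  matches-map : R ⇒ R' → ∀ {P Q} → Matches R P Q → Matches R' P Q
  matches-map f (fwd , bwd) =
      (λ t → let (Q' , u , r) = fwd t in Q' , u , f r)
    , (λ t → let (P' , u , r) = bwd t in P' , u , f r)

  matches-sym : Sym R R' → ∀ {P Q} → Matches R P Q → Matches R' Q P
  matches-sym f (fwd , bwd) =
      (λ t → let (P' , u , r) = bwd t in P' , u , f r)
    , (λ t → let (Q' , u , r) = fwd t in Q' , u , f r)

  matches-trans : Trans R R' R'' →
                  ∀ {P Q W} → Matches R P Q → Matches R' Q W → Matches R'' P W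
  matches-trans f (fwd₁ , bwd₁) (fwd₂ , bwd₂) =
      (λ t → let (_ , u , r) = fwd₁ t ; (W' , v , r') = fwd₂ u in W' , v , f r r')
    , (λ t → let (_ , u , r') = bwd₂ t ; (P' , v , r) = bwd₁ u in P' , v , f r r')

module _ {Act : Set} where

  private
    module F = Matching (_—F[_]→_ {Act})
    module P = Matching (_—[_]→_ {Act})

  ∥-swapʳ : ∀ {F G H : FProc Act} → (F ∥ G) ∥ H ≡F (F ∥ H) ∥ G
  ∥-swapʳ = transF assocF (transF (parF reflF commF) (symF assocF))

  ∣-swapʳ : ∀ {P Q R : Proc Act} → (P ∣ Q) ∣ R ≡D (P ∣ R) ∣ Q
  ∣-swapʳ = transD assocD (transD (parD reflD commD) (symD assocD))

  ∣-swapˡ : ∀ {P Q R : Proc Act} → P ∣ (Q ∣ R) ≡D Q ∣ (P ∣ R)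
  ∣-swapˡ = transD (symD assocD) (transD (parD commD reflD) assocD)

  copies-step : ∀ k {α β} {F G : FProc Act} → copies k α F —F[ β ]→ G →
                β ≡ α × G ∥ α · F ≡F F ∥ copies k α F
  copies-step (suc k) (parR pre) = refl , transF ∥-swapʳ commF
  copies-step (suc k) (parL t) with copies-step k t
  ... | refl , e = refl , transF (parF e reflF) assocF

  ≡F-bisimulation : F.Progresses _≡F_ _≡F_
  ≡F-bisimulation reflF          = F.matches-refl reflF
  ≡F-bisimulation (symF e)       = F.matches-sym symF (≡F-bisimulation e)
  ≡F-bisimulation (transF e e')  =
    F.matches-trans transF (≡F-bisimulation e) (≡F-bisimulation e')
  ≡F-bisimulation (preF e)       = (λ { pre → _ , pre , e }) , (λ { pre → _ , pre , e })
  ≡F-bisimulation (parF e₁ e₂)   with ≡F-bisimulation e₁ | ≡F-bisimulation e₂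
  ... | fwd₁ , bwd₁ | fwd₂ , bwd₂ =
      (λ { (parL t) → let (_ , u , r) = fwd₁ t in _ , parL u , parF r e₂
         ; (parR t) → let (_ , u , r) = fwd₂ t in _ , parR u , parF e₁ r })
    , (λ { (parL t) → let (_ , u , r) = bwd₁ t in _ , parL u , parF r e₂
         ; (parR t) → let (_ , u , r) = bwd₂ t in _ , parR u , parF e₁ r })
  ≡F-bisimulation assocF =
      (λ { (parL (parL t)) → _ , parL t , assocF
         ; (parL (parR t)) → _ , parR (parL t) , assocF
         ; (parR t)        → _ , parR (parR t) , assocF })
    , (λ { (parL t)        → _ , parL (parL t) , assocF
         ; (parR (parL t)) → _ , parL (parR t) , assocF
         ; (parR (parR t)) → _ , parR t , assocF })
  ≡F-bisimulation commF =
      (λ { (parL t) → _ , parR t , commF ; (parR t) → _ , parL t , commF })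
    , (λ { (parL t) → _ , parR t , commF ; (parR t) → _ , parL t , commF })
  ≡F-bisimulation unitF =
    (λ { (parL t) → _ , t , unitF ; (parR ()) }) , (λ t → _ , parL t , unitF)
  ≡F-bisimulation (distF k) =
      (λ { pre → _ , parR pre , commF })
    , (λ { (parR pre) → _ , pre , commF
         ; (parL t)   → copy-fires t })
    where
    copy-fires : ∀ {α β} {F G : FProc Act} → copies k α F —F[ β ]→ G →
                 ∃ λ H → (α · (F ∥ copies k α F)) —F[ β ]→ H × H ≡F G ∥ α · F
    copy-fires t with copies-step k t
    ... | refl , e = _ , pre , symF e

  ≡D-bisimulation : IsBisimulation (_≡D_ {Act})
  ≡D-bisimulation reflD         = P.matches-refl reflD
  ≡D-bisimulation (symD e)      = P.matches-sym symD (≡D-bisimulation e)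
  ≡D-bisimulation (transD e e') =
    P.matches-trans transD (≡D-bisimulation e) (≡D-bisimulation e')
  ≡D-bisimulation (finD e) with ≡F-bisimulation e
  ... | fwd , bwd =
      (λ { (fin→ t) → let (_ , u , r) = fwd t in _ , fin→ u , finD r })
    , (λ { (fin→ t) → let (_ , u , r) = bwd t in _ , fin→ u , finD r })
  ≡D-bisimulation (bangD e) =
      (λ { rep → _ , rep , parD (bangD e) (finD e) })
    , (λ { rep → _ , rep , parD (bangD e) (finD e) })
  ≡D-bisimulation (parD e₁ e₂) with ≡D-bisimulation e₁ | ≡D-bisimulation e₂
  ... | fwd₁ , bwd₁ | fwd₂ , bwd₂ =
      (λ { (parL t) → let (_ , u , r) = fwd₁ t in _ , parL u , parD r e₂
         ; (parR t) → let (_ , u , r) = fwd₂ t in _ , parR u , parD e₁ r })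
    , (λ { (parL t) → let (_ , u , r) = bwd₁ t in _ , parL u , parD r e₂
         ; (parR t) → let (_ , u , r) = bwd₂ t in _ , parR u , parD e₁ r })
  ≡D-bisimulation assocD =
      (λ { (parL (parL t)) → _ , parL t , assocD
         ; (parL (parR t)) → _ , parR (parL t) , assocD
         ; (parR t)        → _ , parR (parR t) , assocD })
    , (λ { (parL t)        → _ , parL (parL t) , assocD
         ; (parR (parL t)) → _ , parL (parR t) , assocD
         ; (parR (parR t)) → _ , parR t , assocD })
  ≡D-bisimulation commD =
      (λ { (parL t) → _ , parR t , commD ; (parR t) → _ , parL t , commD })
    , (λ { (parL t) → _ , parR t , commD ; (parR t) → _ , parL t , commD })
  ≡D-bisimulation unitD =
    (λ { (parL t) → _ , t , unitD ; (parR (fin→ ())) }) , (λ t → _ , parL t , unitD)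
  ≡D-bisimulation finPar =
      (λ { (fin→ (parL t)) → _ , parL (fin→ t) , finPar
         ; (fin→ (parR t)) → _ , parR (fin→ t) , finPar })
    , (λ { (parL (fin→ t)) → _ , fin→ (parL t) , finPar
         ; (parR (fin→ t)) → _ , fin→ (parR t) , finPar })

  data ParClosure (R : Rel (Proc Act) 0ℓ) : Rel (Proc Act) 0ℓ where
    base : R ⇒ ParClosure R
    parL : ∀ {P Q S} → ParClosure R P Q → ParClosure R (P ∣ S) (Q ∣ S)
    parR : ∀ {P Q S} → ParClosure R P Q → ParClosure R (S ∣ P) (S ∣ Q)

  ParClosure-mono : ∀ {R R'} → R ⇒ R' → ParClosure R ⇒ ParClosure R'
  ParClosure-mono f (base r) = base (f r)
  ParClosure-mono f (parL c) = parL (ParClosure-mono f c)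
  ParClosure-mono f (parR c) = parR (ParClosure-mono f c)

  UpToStep : Rel (Proc Act) 0ℓ → Rel (Proc Act) 0ℓ
  UpToStep R = ParClosure R ∪ flip (ParClosure R) ∪ _≡D_

  UpTo : Rel (Proc Act) 0ℓ → Rel (Proc Act) 0ℓ
  UpTo R = Star (UpToStep R)

  module _ {R : Rel (Proc Act) 0ℓ} where

    upTo-base : R ⇒ UpTo R
    upTo-base = return ∘ inj₁ ∘ base

    upTo-≡D : _≡D_ ⇒ UpTo R
    upTo-≡D = return ∘ inj₂ ∘ inj₂

    upTo-sym : Sym (UpTo R) (UpTo R)
    upTo-sym = reverse λ { (inj₁ c)        → inj₂ (inj₁ c)
                         ; (inj₂ (inj₁ c)) → inj₁ c
                         ; (inj₂ (inj₂ e)) → inj₂ (inj₂ (symD e)) }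

    upTo-∣ˡ : ∀ {P Q S} → UpTo R P Q → UpTo R (P ∣ S) (Q ∣ S)
    upTo-∣ˡ {S = S} = gmap (_∣ S) λ { (inj₁ c)        → inj₁ (parL c)
                                    ; (inj₂ (inj₁ c)) → inj₂ (inj₁ (parL c))
                                    ; (inj₂ (inj₂ e)) → inj₂ (inj₂ (parD e reflD)) }

    upTo-∣ʳ : ∀ {P Q S} → UpTo R P Q → UpTo R (S ∣ P) (S ∣ Q)
    upTo-∣ʳ {S = S} = gmap (S ∣_) λ { (inj₁ c)        → inj₁ (parR c)
                                    ; (inj₂ (inj₁ c)) → inj₂ (inj₁ (parR c))
                                    ; (inj₂ (inj₂ e)) → inj₂ (inj₂ (parD reflD e)) }

    upTo-mono : ∀ {R'} → R ⇒ R' → UpTo R ⇒ UpTo R'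
    upTo-mono f = map λ { (inj₁ c)        → inj₁ (ParClosure-mono f c)
                        ; (inj₂ (inj₁ c)) → inj₂ (inj₁ (ParClosure-mono f c))
                        ; (inj₂ (inj₂ e)) → inj₂ (inj₂ e) }

    module _ (progress : P.Progresses R (UpTo R)) where

      ParClosure-progress : P.Progresses (ParClosure R) (UpTo R)
      ParClosure-progress (base r) = progress r
      ParClosure-progress (parL c) with ParClosure-progress c
      ... | fwd , bwd =
          (λ { (parL t) → let (_ , u , r) = fwd t in _ , parL u , upTo-∣ˡ r
             ; (parR t) → _ , parR t , return (inj₁ (parL c)) })
        , (λ { (parL t) → let (_ , u , r) = bwd t in _ , parL u , upTo-∣ˡ r
             ; (parR t) → _ , parR t , return (inj₁ (parL c)) })
      ParClosure-progress (parR c) with ParClosure-progress c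
      ... | fwd , bwd =
          (λ { (parR t) → let (_ , u , r) = fwd t in _ , parR u , upTo-∣ʳ r
             ; (parL t) → _ , parL t , return (inj₁ (parR c)) })
        , (λ { (parR t) → let (_ , u , r) = bwd t in _ , parR u , upTo-∣ʳ r
             ; (parL t) → _ , parL t , return (inj₁ (parR c)) })

      upTo-bisimulation : IsBisimulation (UpTo R)
      upTo-bisimulation ε        = P.matches-refl ε
      upTo-bisimulation (s ◅ ss) =
        P.matches-trans _◅◅_ (step-progress s) (upTo-bisimulation ss)
        where
        step-progress : P.Progresses (UpToStep R) (UpTo R)
        step-progress (inj₁ c)        = ParClosure-progress c
        step-progress (inj₂ (inj₁ c)) = P.matches-sym upTo-sym (ParClosure-progress c)
        step-progress (inj₂ (inj₂ e)) = P.matches-map upTo-≡D (≡D-bisimulation e)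

  bisimulation-upTo : ∀ {R} → IsBisimulation R → IsBisimulation (UpTo R)
  bisimulation-upTo bisim = upTo-bisimulation (P.matches-map upTo-base ∘ bisim)

  data Duplicate : Rel (Proc Act) 0ℓ where
    duplicate : ∀ {α F P} → Duplicate (! α ∙ F ∣ (! α ∙ F ∣ P)) (! α ∙ F ∣ P)

  Duplicate-progress : P.Progresses Duplicate (UpTo Duplicate)
  Duplicate-progress duplicate =
      (λ { (parL rep)        → _ , parL rep , outer-fires
         ; (parR (parL rep)) → _ , parL rep ,
             upTo-≡D (parD reflD assocD) ◅◅ upTo-base duplicate ◅◅ upTo-≡D (symD assocD)
         ; (parR (parR t))   → _ , parR t , upTo-base duplicate })
    , (λ { (parL rep) → _ , parL rep , outer-fires
         ; (parR t)   → _ , parR (parR t) , upTo-base duplicate })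
    where
    outer-fires : ∀ {α F P} →
      UpTo Duplicate ((! α ∙ F ∣ fin F) ∣ (! α ∙ F ∣ P)) ((! α ∙ F ∣ fin F) ∣ P)
    outer-fires = upTo-≡D (transD assocD (parD reflD ∣-swapˡ))
                  ◅◅ upTo-base duplicate ◅◅ upTo-≡D (symD assocD)

  module Erasure (α : Act) (F : FProc Act) where

    infix 4 _▷F_ _▷_

    data _▷F_ : FProc Act → FProc Act → Set where
      erase  : α · F ▷F 𝟘
      nil    : 𝟘 ▷F 𝟘
      prefix : ∀ {β G H} → G ▷F H → β · G ▷F β · H
      par    : ∀ {G₁ G₂ H₁ H₂} → G₁ ▷F H₁ → G₂ ▷F H₂ → G₁ ∥ G₂ ▷F H₁ ∥ H₂

    data _▷_ : Proc Act → Proc Act → Set where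
      fin  : ∀ {G H} → G ▷F H → fin G ▷ fin H
      bang : ∀ {β G H} → G ▷F H → ! β ∙ G ▷ ! β ∙ H
      par  : ∀ {X₁ X₂ Y₁ Y₂} → X₁ ▷ Y₁ → X₂ ▷ Y₂ → X₁ ∣ X₂ ▷ Y₁ ∣ Y₂

    ▷F-refl : ∀ G → G ▷F G
    ▷F-refl 𝟘       = nil
    ▷F-refl (β · G) = prefix (▷F-refl G)
    ▷F-refl (G ∥ H) = par (▷F-refl G) (▷F-refl H)

    ▷-refl : ∀ X → X ▷ X
    ▷-refl (fin G)   = fin (▷F-refl G)
    ▷-refl (! β ∙ G) = bang (▷F-refl G)
    ▷-refl (X ∣ Y)   = par (▷-refl X) (▷-refl Y)

    fillD-▷F : ∀ D → fillD D (α · F) ▷F fillD D 𝟘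
    fillD-▷F hole     = erase
    fillD-▷F (β ·ᴰ D) = prefix (fillD-▷F D)
    fillD-▷F (D ∥ᴰ G) = par (fillD-▷F D) (▷F-refl G)

    fill-▷ : ∀ C → fill C (α · F) ▷ fill C 𝟘
    fill-▷ (ctxD D)   = fin (fillD-▷F D)
    fill-▷ (!ᶜ β ∙ D) = bang (fillD-▷F D)
    fill-▷ (C ∣ᶜ X)   = par (fill-▷ C) (▷-refl X)

    ▷F-forward : ∀ {G H β G'} → G ▷F H → G —F[ β ]→ G' →
                 (∃ λ H' → H —F[ β ]→ H' × G' ▷F H') ⊎
                 (β ≡ α × ∃ λ W → G' ▷F W × W ≡F H ∥ F)
    ▷F-forward erase pre = inj₂ (refl , F , ▷F-refl F , transF (symF unitF) commF)
    ▷F-forward (prefix e) pre = inj₁ (_ , pre , e)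
    ▷F-forward (par e₁ e₂) (parL t) with ▷F-forward e₁ t
    ... | inj₁ (_ , u , e)      = inj₁ (_ , parL u , par e e₂)
    ... | inj₂ (refl , _ , e , w) = inj₂ (refl , _ , par e e₂ , transF (parF w reflF) ∥-swapʳ)
    ▷F-forward (par e₁ e₂) (parR t) with ▷F-forward e₂ t
    ... | inj₁ (_ , u , e)      = inj₁ (_ , parR u , par e₁ e)
    ... | inj₂ (refl , _ , e , w) = inj₂ (refl , _ , par e₁ e , transF (parF reflF w) (symF assocF))

    ▷F-backward : ∀ {G H β H'} → G ▷F H → H —F[ β ]→ H' →
                  ∃ λ G' → G —F[ β ]→ G' × G' ▷F H'
    ▷F-backward (prefix e) pre = _ , pre , e
    ▷F-backward (par e₁ e₂) (parL t) = let (_ , u , e) = ▷F-backward e₁ t in _ , parL u , par e e₂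
    ▷F-backward (par e₁ e₂) (parR t) = let (_ , u , e) = ▷F-backward e₂ t in _ , parR u , par e₁ e

    ▷-forward : ∀ {X Y β X'} → X ▷ Y → X —[ β ]→ X' →
                (∃ λ Y' → Y —[ β ]→ Y' × X' ▷ Y') ⊎
                (β ≡ α × ∃ λ W → X' ▷ W × W ≡D Y ∣ fin F)
    ▷-forward (fin e) (fin→ t) with ▷F-forward e t
    ... | inj₁ (_ , u , e')       = inj₁ (_ , fin→ u , fin e')
    ... | inj₂ (refl , _ , e' , w) = inj₂ (refl , _ , fin e' , transD (finD w) finPar)
    ▷-forward (bang e) rep = inj₁ (_ , rep , par (bang e) (fin e))
    ▷-forward (par e₁ e₂) (parL t) with ▷-forward e₁ t
    ... | inj₁ (_ , u , e)        = inj₁ (_ , parL u , par e e₂)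
    ... | inj₂ (refl , _ , e , w) = inj₂ (refl , _ , par e e₂ , transD (parD w reflD) ∣-swapʳ)
    ▷-forward (par e₁ e₂) (parR t) with ▷-forward e₂ t
    ... | inj₁ (_ , u , e)        = inj₁ (_ , parR u , par e₁ e)
    ... | inj₂ (refl , _ , e , w) = inj₂ (refl , _ , par e₁ e , transD (parD reflD w) (symD assocD))

    ▷-backward : ∀ {X Y β Y'} → X ▷ Y → Y —[ β ]→ Y' →
                 ∃ λ X' → X —[ β ]→ X' × X' ▷ Y'
    ▷-backward (fin e) (fin→ t) = let (_ , u , e') = ▷F-backward e t in _ , fin→ u , fin e'
    ▷-backward (bang e) rep = _ , rep , par (bang e) (fin e)
    ▷-backward (par e₁ e₂) (parL t) = let (_ , u , e) = ▷-backward e₁ t in _ , parL u , par e e₂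
    ▷-backward (par e₁ e₂) (parR t) = let (_ , u , e) = ▷-backward e₂ t in _ , parR u , par e₁ e

  module _ {B : Rel (Proc Act) 0ℓ} (B-bisim : IsBisimulation B) where

    Absorbs : Act → FProc Act → Proc Act → Set
    Absorbs α F Y = ∃ λ Z → UpTo B Y (! α ∙ F ∣ Z)

    absorbs-step : ∀ {α F Y β Y'} → Absorbs α F Y → Y —[ β ]→ Y' → Absorbs α F Y'
    absorbs-step (Z , c) t with proj₁ (bisimulation-upTo B-bisim c) t
    ... | _ , parL rep , c' = _ , c' ◅◅ upTo-≡D assocD
    ... | _ , parR _   , c' = _ , c'

    data Erased : Rel (Proc Act) 0ℓ where
      erased : ∀ {X Y} α F → Erasure._▷_ α F X Y → Absorbs α F Y → Erased X Y

    Erased-progress : P.Progresses Erased (UpTo (B ∪ Erased))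
    Erased-progress (erased α F e ab@(_ , c)) = forward , backward
      where
      open Erasure α F
      forward : ∀ {β X'} → _ —[ β ]→ X' → ∃ λ Y' → _ —[ β ]→ Y' × UpTo (B ∪ Erased) X' Y'
      forward t with ▷-forward e t
      ... | inj₁ (_ , u , e') = _ , u , upTo-base (inj₂ (erased α F e' (absorbs-step ab u)))
      -- an erased α · F fired: X' ▷ W ≡D Y ∣ F, answered by Y's copy of ! α ∙ F
      ... | inj₂ (refl , _ , e' , w) with proj₂ (bisimulation-upTo B-bisim c) (parL rep)
      ... | _ , u , c' = _ , u ,
        upTo-base (inj₂ (erased α F e' (_ , upTo-≡D w ◅◅ upTo-∣ˡ c ◅◅ upTo-≡D assocD)))
        ◅◅ upTo-≡D w ◅◅ upTo-mono inj₁ (upTo-∣ˡ c) ◅◅ upTo-≡D ∣-swapʳ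
        ◅◅ upTo-mono inj₁ (upTo-sym c')
      backward : ∀ {β Y'} → _ —[ β ]→ Y' → ∃ λ X' → _ —[ β ]→ X' × UpTo (B ∪ Erased) X' Y'
      backward t =
        let (_ , u , e') = ▷-backward e t
        in _ , u , upTo-base (inj₂ (erased α F e' (absorbs-step ab t)))

  ∼-closed-under-—→⁻¹ : ∀ {P P' T : Proc Act} → P —→[ T ] P' → P' ∼ T → P ∼ T
  ∼-closed-under-—→⁻¹ {T = T} (P₀ , P₀' , P≡P₀ , step , P₀'≡P') (B , B-bisim , P'BT) =
    UpTo R , upTo-bisimulation R-progress ,
    upTo-≡D P≡P₀ ◅◅ base-step step ◅◅ upTo-≡D P₀'≡P' ◅◅ upTo-base (inj₁ P'BT)
    where
    R : Rel (Proc Act) 0ℓ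
    R = B ∪ Duplicate ∪ Erased B-bisim

    R-progress : P.Progresses R (UpTo R)
    R-progress (inj₁ b)        = P.matches-map (upTo-base ∘ inj₁) (B-bisim b)
    R-progress (inj₂ (inj₁ d)) = P.matches-map (upTo-mono (inj₂ ∘ inj₁)) (Duplicate-progress d)
    R-progress (inj₂ (inj₂ k)) = P.matches-map (upTo-mono (map₂ inj₂)) (Erased-progress B-bisim k)

    base-step : BaseStep T P₀ P₀' → UpTo R P₀ P₀'
    base-step (B1 {C} {α} {F} (F' , T≡)) =
      upTo-base (inj₂ (inj₂ (erased α F (Erasure.fill-▷ α F C)
        (F' , upTo-≡D P₀'≡P' ◅◅ upTo-base P'BT ◅◅ upTo-≡D T≡))))
    base-step B2 = upTo-base (inj₂ (inj₁ duplicate))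

lemma10 : {Act : Set} → Act ↣ ℕ →
    (Q T : Proc Act) → Q ⇒[ T ] T → Q ∼ T
lemma10 _ Q T ε        = _≡D_ , ≡D-bisimulation , reflD
lemma10 i Q T (s ◅ ss) = ∼-closed-under-—→⁻¹ s (lemma10 i _ T ss)
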